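{- Let $a,b,c,d\in\mathbb{C}$ with $a+b+c+d=1$ and $a+c,a+d\notin\{0,-1,-2,\ldots\}$, and let $x\in\mathbb{C}$. Then for every $n\ge0$, $$\sum_{k=0}^n(-i)^k\frac{(-n)_k\,k!}{(1+n)_k(a+c)_k(a+d)_k}p_k(x;a,b,c,d)=\frac{n!\,(a+ix)_n+(a+c)_n(a+d)_n}{2(a+c)_n(a+d)_n}.$$
   Context: Rising factorial: $(\gamma)_0=1$, $(\gamma)_k=\gamma(\gamma+1)\cdots(\gamma+k-1)$; $i=\sqrt{ -1}$. The continuous Hahn polynomials are $p_n(x;a,b,c,d)=i^n\frac{(a+c)_n(a+d)_n}{n!}\sum_{j=0}^n\frac{(-n)_j(n+a+b+c+d-1)_j(a+ix)_j}{j!\,(a+c)_j(a+d)_j}$. -}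

module Defs where

open import Level using (Level; _⊔_)
open import Data.Nat as ℕ using (ℕ; zero; suc)
open import Data.Nat.Base using (_!)
open import Algebra.Bundles using (CommutativeRing)
open import Relation.Nullary using (¬_)

natEmb : {c ℓ : Level} (R : CommutativeRing c ℓ) → ℕ → CommutativeRing.Carrier R
natEmb R zero    = CommutativeRing.0# R
natEmb R (suc m) = CommutativeRing._+_ R (CommutativeRing.1# R) (natEmb R m)

-- A field of characteristic zero containing a square root of -1.
-- (Stands in for ℂ, which agda-stdlib does not provide.)
-- The inverse is total; its value at 0 is irrelevant (never used below
-- at a zero argument under the theorem's hypotheses).
record CharZeroFieldWithI (c ℓ : Level) : Set (Level.suc (c ⊔ ℓ)) where
  field
    commRing : CommutativeRing c ℓ
  open CommutativeRing commRing public
  field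
    _⁻¹      : Carrier → Carrier
    ⁻¹-cong  : ∀ {x y} → x ≈ y → x ⁻¹ ≈ y ⁻¹
    inverseʳ : ∀ x → ¬ (x ≈ 0#) → x * (x ⁻¹) ≈ 1#
    1≉0      : ¬ (1# ≈ 0#)
    charZero : ∀ m → ¬ (natEmb commRing (suc m) ≈ 0#)
    i        : Carrier
    i²≈-1    : i * i ≈ - 1#

module Hahn {c ℓ : Level} (F : CharZeroFieldWithI c ℓ) where
  open CharZeroFieldWithI F public

  ι : ℕ → Carrier
  ι = natEmb commRing

  infixl 7 _/_
  _/_ : Carrier → Carrier → Carrier
  x / y = x * (y ⁻¹)

  infixr 8 _^_
  _^_ : Carrier → ℕ → Carrier
  x ^ zero  = 1#
  x ^ suc k = x * (x ^ k)

  poch : Carrier → ℕ → Carrier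
  poch γ zero    = 1#
  poch γ (suc k) = poch γ k * (γ + ι k)

  sumTo : ℕ → (ℕ → Carrier) → Carrier
  sumTo zero    f = f 0
  sumTo (suc n) f = sumTo n f + f (suc n)

  fact : ℕ → Carrier
  fact k = ι (k !)

  p : ℕ → Carrier → Carrier → Carrier → Carrier → Carrier → Carrier
  p n x a b c d =
    (i ^ n) * (poch (a + c) n * poch (a + d) n / fact n)
      * sumTo n (λ j →
          poch (- ι n) j * poch (ι n + a + b + c + d - 1#) j * poch (a + i * x) j
            / (fact j * poch (a + c) j * poch (a + d) j))

-- Since a + b + c + d = 1, the parameter n + a + b + c + d - 1 of p_k equals k,
-- so the k-th summand is w_k Σ_j (-k)_j (k)_j u_j with w_k = (-n)_k / (n+1)_k and
-- u_j = (a+ix)_j / (j! (a+c)_j (a+d)_j). Interchanging the sums, u_j gets the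
-- coefficient E_j = Σ_k w_k (-k)_j (k)_j. From w_{k+1} (k+1+n) = w_k (k-n),
-- summation by parts turns Σ_k w_k ((k-n) h(k+1) - (k+n) h(k)) into -n h(0);
-- h ≡ 1 gives 2 E_0 = 1 and h(k) = (1-k)_j (k)_j gives E_j = 0 for 0 < j < n,
-- while in E_n only k = n survives, so 2 E_n = (n!)^2. The sum is therefore
-- (1 + (n!)^2 u_n) / 2.

module Submission where

open import Defs
open import Level using (Level)
open import Data.Nat as ℕ using (ℕ; zero; suc; _!; _≤_; _<_; z≤n; s≤s)
import Data.Nat.Properties as ℕ
open import Data.Integer as ℤ using (ℤ)
import Data.Integer.Properties as ℤ
open import Data.Sign as Sign using (Sign)
open import Data.Maybe using (Maybe; nothing; just)
open import Relation.Nullary using (¬_; yes; no; contradiction)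
open import Relation.Binary.PropositionalEquality as ≡ using (_≡_)
open import Algebra.Bundles using (CommutativeRing)
open import Algebra.Solver.Ring.AlmostCommutativeRing
  using (fromCommutativeRing; _-Raw-AlmostCommutative⟶_)
import Algebra.Solver.Ring as RingSolver

-- The ring solver for an arbitrary commutative ring, with integer
-- coefficients so that cancellations such as x - x ≈ 0 are recognised.
module IntegerCoefficients {c ℓ : Level} (R : CommutativeRing c ℓ) where
  open CommutativeRing R
  open import Algebra.Properties.Ring ring using (-‿involutive; -1*x≈-x; -0#≈0#; -‿+-comm)
  open import Relation.Binary.Reasoning.Setoid setoid

  private
    ι : ℕ → Carrier
    ι = natEmb R

  natEmb-+ : ∀ m k → ι (m ℕ.+ k) ≈ ι m + ι k
  natEmb-+ zero    k = sym (+-identityˡ _)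
  natEmb-+ (suc m) k = trans (+-cong refl (natEmb-+ m k)) (sym (+-assoc _ _ _))

  natEmb-* : ∀ m k → ι (m ℕ.* k) ≈ ι m * ι k
  natEmb-* zero    k = sym (zeroˡ _)
  natEmb-* (suc m) k = begin
    ι (k ℕ.+ m ℕ.* k)    ≈⟨ natEmb-+ k (m ℕ.* k) ⟩
    ι k + ι (m ℕ.* k)    ≈⟨ +-cong (sym (*-identityˡ _)) (natEmb-* m k) ⟩
    1# * ι k + ι m * ι k ≈⟨ distribʳ _ _ _ ⟨
    (1# + ι m) * ι k     ∎

  intEmb : ℤ → Carrier
  intEmb (ℤ.+ n)    = ι n
  intEmb ℤ.-[1+ n ] = - ι (suc n)

  private
    signEmb : Sign → Carrier
    signEmb Sign.+ = 1#
    signEmb Sign.- = - 1#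

    signEmb-* : ∀ s t → signEmb (s Sign.* t) ≈ signEmb s * signEmb t
    signEmb-* Sign.+ Sign.+ = sym (*-identityˡ 1#)
    signEmb-* Sign.+ Sign.- = sym (*-identityˡ _)
    signEmb-* Sign.- Sign.+ = sym (*-identityʳ _)
    signEmb-* Sign.- Sign.- = sym (trans (-1*x≈-x (- 1#)) (-‿involutive 1#))

    intEmb-◃ : ∀ s n → intEmb (s ℤ.◃ n) ≈ signEmb s * ι n
    intEmb-◃ s      zero    = sym (zeroʳ _)
    intEmb-◃ Sign.+ (suc n) = sym (*-identityˡ _)
    intEmb-◃ Sign.- (suc n) = sym (-1*x≈-x _)

    intEmb-signAbs : ∀ z → intEmb z ≈ signEmb (ℤ.sign z) * ι ℤ.∣ z ∣
    intEmb-signAbs (ℤ.+ n)    = sym (*-identityˡ _)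
    intEmb-signAbs ℤ.-[1+ n ] = sym (-1*x≈-x _)

    intEmb-⊖ : ∀ m n → intEmb (m ℤ.⊖ n) ≈ ι m - ι n
    intEmb-⊖ zero    zero    = sym (-‿inverseʳ 0#)
    intEmb-⊖ zero    (suc n) = sym (+-identityˡ _)
    intEmb-⊖ (suc m) zero    = sym (trans (+-cong refl -0#≈0#) (+-identityʳ _))
    intEmb-⊖ (suc m) (suc n) rewrite ℤ.[1+m]⊖[1+n]≡m⊖n m n = begin
      intEmb (m ℤ.⊖ n)             ≈⟨ intEmb-⊖ m n ⟩
      ι m - ι n                    ≈⟨ +-identityˡ _ ⟨
      0# + (ι m - ι n)             ≈⟨ +-cong (-‿inverseʳ 1#) refl ⟨
      (1# - 1#) + (ι m - ι n)      ≈⟨ +-assoc _ _ _ ⟩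
      1# + (- 1# + (ι m - ι n))    ≈⟨ +-cong refl (+-cong refl (+-comm _ _)) ⟩
      1# + (- 1# + (- ι n + ι m))  ≈⟨ +-cong refl (+-assoc _ _ _) ⟨
      1# + ((- 1# - ι n) + ι m)    ≈⟨ +-cong refl (+-comm _ _) ⟩
      1# + (ι m + (- 1# - ι n))    ≈⟨ +-assoc _ _ _ ⟨
      (1# + ι m) + (- 1# - ι n)    ≈⟨ +-cong refl (-‿+-comm 1# (ι n)) ⟩
      (1# + ι m) - (1# + ι n)      ∎

    intEmb-+ : ∀ a b → intEmb (a ℤ.+ b) ≈ intEmb a + intEmb b
    intEmb-+ ℤ.-[1+ m ] ℤ.-[1+ n ] = begin
      - ι (suc (suc (m ℕ.+ n)))    ≡⟨ ≡.cong (λ t → - ι (suc t)) (ℕ.+-suc m n) ⟨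
      - ι (suc m ℕ.+ suc n)        ≈⟨ -‿cong (natEmb-+ (suc m) (suc n)) ⟩
      - (ι (suc m) + ι (suc n))    ≈⟨ -‿+-comm _ _ ⟨
      - ι (suc m) + - ι (suc n)    ∎
    intEmb-+ ℤ.-[1+ m ] (ℤ.+ n)    = trans (intEmb-⊖ n (suc m)) (+-comm _ _)
    intEmb-+ (ℤ.+ m)    ℤ.-[1+ n ] = intEmb-⊖ m (suc n)
    intEmb-+ (ℤ.+ m)    (ℤ.+ n)    = natEmb-+ m n

    intEmb-* : ∀ a b → intEmb (a ℤ.* b) ≈ intEmb a * intEmb b
    intEmb-* a b = begin
      intEmb (a ℤ.* b)                          ≈⟨ intEmb-◃ (sa Sign.* sb) (∣a∣ ℕ.* ∣b∣) ⟩
      signEmb (sa Sign.* sb) * ι (∣a∣ ℕ.* ∣b∣)  ≈⟨ *-cong (signEmb-* sa sb) (natEmb-* ∣a∣ ∣b∣) ⟩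
      (signEmb sa * signEmb sb) * (ι ∣a∣ * ι ∣b∣) ≈⟨ interchange _ _ _ _ ⟩
      (signEmb sa * ι ∣a∣) * (signEmb sb * ι ∣b∣) ≈⟨ *-cong (intEmb-signAbs a) (intEmb-signAbs b) ⟨
      intEmb a * intEmb b                       ∎
      where
      sa = ℤ.sign a
      sb = ℤ.sign b
      ∣a∣ = ℤ.∣ a ∣
      ∣b∣ = ℤ.∣ b ∣
      interchange : ∀ p q r s → (p * q) * (r * s) ≈ (p * r) * (q * s)
      interchange p q r s = begin
        (p * q) * (r * s) ≈⟨ *-assoc _ _ _ ⟩
        p * (q * (r * s)) ≈⟨ *-cong refl (*-assoc _ _ _) ⟨
        p * ((q * r) * s) ≈⟨ *-cong refl (*-cong (*-comm _ _) refl) ⟩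
        p * ((r * q) * s) ≈⟨ *-cong refl (*-assoc _ _ _) ⟩
        p * (r * (q * s)) ≈⟨ *-assoc _ _ _ ⟨
        (p * r) * (q * s) ∎

    intEmb-neg : ∀ a → intEmb (ℤ.- a) ≈ - intEmb a
    intEmb-neg ℤ.-[1+ n ]    = sym (-‿involutive _)
    intEmb-neg (ℤ.+ zero)    = sym -0#≈0#
    intEmb-neg (ℤ.+ (suc n)) = refl

    intEmb-homomorphism : ℤ.+-*-rawRing -Raw-AlmostCommutative⟶ fromCommutativeRing R
    intEmb-homomorphism = record
      { ⟦_⟧    = intEmb
      ; +-homo = intEmb-+
      ; *-homo = intEmb-*
      ; -‿homo = intEmb-neg
      ; 0-homo = refl
      ; 1-homo = +-identityʳ 1#
      }

    intEmb-≟ : (a b : ℤ) → Maybe (intEmb a ≈ intEmb b)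
    intEmb-≟ a b with a ℤ.≟ b
    ... | yes ≡.refl = just refl
    ... | no _       = nothing

  open RingSolver ℤ.+-*-rawRing (fromCommutativeRing R) intEmb-homomorphism intEmb-≟ public

module ContinuousHahn {ℓc ℓ : Level} (F : CharZeroFieldWithI ℓc ℓ) where
  open Hahn F
  open IntegerCoefficients commRing using (natEmb-+; natEmb-*; solve; _:=_; _:+_; _:*_; _:-_; :-_)
  open import Algebra.Properties.Ring ring
    using (-‿distribˡ-*; -‿involutive; -0#≈0#; +-cancelˡ; +-inverseˡ-unique; x∙y⁻¹≈ε⇒x≈y)
  open import Relation.Binary.Reasoning.Setoid setoid

  *-inverseˡ : ∀ {x} → x ≉ 0# → x ⁻¹ * x ≈ 1#
  *-inverseˡ {x} x≉0 = trans (*-comm _ _) (inverseʳ x x≉0)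

  *-cancelˡ : ∀ {x y z} → x ≉ 0# → x * y ≈ x * z → y ≈ z
  *-cancelˡ {x} {y} {z} x≉0 xy≈xz = begin
    y              ≈⟨ *-identityˡ y ⟨
    1# * y         ≈⟨ *-cong (*-inverseˡ x≉0) refl ⟨
    (x ⁻¹ * x) * y ≈⟨ *-assoc _ _ _ ⟩
    x ⁻¹ * (x * y) ≈⟨ *-cong refl xy≈xz ⟩
    x ⁻¹ * (x * z) ≈⟨ *-assoc _ _ _ ⟨
    (x ⁻¹ * x) * z ≈⟨ *-cong (*-inverseˡ x≉0) refl ⟩
    1# * z         ≈⟨ *-identityˡ z ⟩
    z              ∎

  *-≉0 : ∀ {x y} → x ≉ 0# → y ≉ 0# → x * y ≉ 0#
  *-≉0 {x} x≉0 y≉0 xy≈0 = y≉0 (*-cancelˡ x≉0 (trans xy≈0 (sym (zeroʳ x))))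

  ⁻¹-distrib-* : ∀ {x y} → x ≉ 0# → y ≉ 0# → (x * y) ⁻¹ ≈ x ⁻¹ * y ⁻¹
  ⁻¹-distrib-* {x} {y} x≉0 y≉0 = *-cancelˡ xy≉0 (begin
    (x * y) * (x * y) ⁻¹     ≈⟨ inverseʳ _ xy≉0 ⟩
    1#                       ≈⟨ *-identityˡ 1# ⟨
    1# * 1#                  ≈⟨ *-cong (inverseʳ x x≉0) (inverseʳ y y≉0) ⟨
    (x * x ⁻¹) * (y * y ⁻¹)  ≈⟨ solve 4 (λ x y x' y' → (x :* x') :* (y :* y') := (x :* y) :* (x' :* y'))
                                  refl x y (x ⁻¹) (y ⁻¹) ⟩
    (x * y) * (x ⁻¹ * y ⁻¹)  ∎)
    where xy≉0 = *-≉0 x≉0 y≉0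

  /-unique : ∀ {x y z} → y ≉ 0# → z * y ≈ x → z ≈ x / y
  /-unique {x} {y} {z} y≉0 zy≈x = begin
    z               ≈⟨ *-identityʳ z ⟨
    z * 1#          ≈⟨ *-cong refl (inverseʳ y y≉0) ⟨
    z * (y * y ⁻¹)  ≈⟨ *-assoc _ _ _ ⟨
    (z * y) * y ⁻¹  ≈⟨ *-cong zy≈x refl ⟩
    x / y           ∎

  two : Carrier
  two = 1# + 1#

  two*x≈x+x : ∀ x → two * x ≈ x + x
  two*x≈x+x x = trans (distribʳ x 1# 1#) (+-cong (*-identityˡ x) (*-identityˡ x))

  ι-injective : ∀ {m n} → ι m ≈ ι n → m ≡ n
  ι-injective {zero}  {zero}  _  = ≡.refl
  ι-injective {zero}  {suc n} eq = contradiction (sym eq) (charZero n)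
  ι-injective {suc m} {zero}  eq = contradiction eq (charZero m)
  ι-injective {suc m} {suc n} eq = ≡.cong suc (ι-injective (+-cancelˡ 1# _ _ eq))

  two-≉0 : two ≉ 0#
  two-≉0 eq = charZero 1 (trans (+-cong refl (+-identityʳ 1#)) eq)

  fact-≉0 : ∀ n → fact n ≉ 0#
  fact-≉0 n with n ! | ℕ.1≤n! n
  ... | suc m | _ = charZero m

  ι-suc-≉-neg : ∀ n m → ι (suc n) ≉ - ι m
  ι-suc-≉-neg n m eq = charZero (n ℕ.+ m) (begin
    ι (suc n ℕ.+ m)    ≈⟨ natEmb-+ (suc n) m ⟩
    ι (suc n) + ι m    ≈⟨ +-cong eq refl ⟩
    - ι m + ι m        ≈⟨ -‿inverseˡ (ι m) ⟩
    0#                 ∎)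

  sumTo-cong : ∀ n {f g : ℕ → Carrier} → (∀ k → k ≤ n → f k ≈ g k) → sumTo n f ≈ sumTo n g
  sumTo-cong zero    f≈g = f≈g 0 z≤n
  sumTo-cong (suc n) f≈g =
    +-cong (sumTo-cong n (λ k k≤n → f≈g k (ℕ.m≤n⇒m≤1+n k≤n))) (f≈g (suc n) ℕ.≤-refl)

  sumTo-+ : ∀ n (f g : ℕ → Carrier) → sumTo n (λ k → f k + g k) ≈ sumTo n f + sumTo n g
  sumTo-+ zero    f g = refl
  sumTo-+ (suc n) f g = trans (+-cong (sumTo-+ n f g) refl)
    (solve 4 (λ a b c d → (a :+ b) :+ (c :+ d) := (a :+ c) :+ (b :+ d))
           refl (sumTo n f) (sumTo n g) (f (suc n)) (g (suc n)))

  sumTo-*ˡ : ∀ n x (f : ℕ → Carrier) → sumTo n (λ k → x * f k) ≈ x * sumTo n f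
  sumTo-*ˡ zero    x f = refl
  sumTo-*ˡ (suc n) x f = trans (+-cong (sumTo-*ˡ n x f) refl) (sym (distribˡ _ _ _))

  sumTo-*ʳ : ∀ n x (f : ℕ → Carrier) → sumTo n (λ k → f k * x) ≈ sumTo n f * x
  sumTo-*ʳ zero    x f = refl
  sumTo-*ʳ (suc n) x f = trans (+-cong (sumTo-*ʳ n x f) refl) (sym (distribʳ _ _ _))

  sumTo-swap : ∀ n m (g : ℕ → ℕ → Carrier) →
    sumTo n (λ k → sumTo m (g k)) ≈ sumTo m (λ j → sumTo n (λ k → g k j))
  sumTo-swap zero    m g = refl
  sumTo-swap (suc n) m g = trans (+-cong (sumTo-swap n m g) refl) (sym (sumTo-+ m _ _))

  sumTo-telescope : ∀ n (T : ℕ → Carrier) → sumTo n (λ k → T (suc k) - T k) ≈ T (suc n) - T 0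
  sumTo-telescope zero    T = refl
  sumTo-telescope (suc n) T = trans (+-cong (sumTo-telescope n T) refl)
    (solve 3 (λ a b c → (b :- c) :+ (a :- b) := a :- c) refl (T (suc (suc n))) (T (suc n)) (T 0))

  sumTo-vanish : ∀ n {f : ℕ → Carrier} → (∀ k → k ≤ n → f k ≈ 0#) → sumTo n f ≈ 0#
  sumTo-vanish zero    f≈0 = f≈0 0 z≤n
  sumTo-vanish (suc n) f≈0 = begin
    sumTo n _ + _ ≈⟨ +-cong (sumTo-vanish n (λ k k≤n → f≈0 k (ℕ.m≤n⇒m≤1+n k≤n))) (f≈0 (suc n) ℕ.≤-refl) ⟩
    0# + 0#       ≈⟨ +-identityˡ 0# ⟩
    0#            ∎

  sumTo-≈-last : ∀ n {f : ℕ → Carrier} → (∀ k → k < n → f k ≈ 0#) → sumTo n f ≈ f n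
  sumTo-≈-last zero    _   = refl
  sumTo-≈-last (suc n) f≈0 = trans (+-cong (sumTo-vanish n (λ k k≤n → f≈0 k (s≤s k≤n))) refl) (+-identityˡ _)

  sumTo-≈-head : ∀ n {f : ℕ → Carrier} → (∀ k → 0 < k → k ≤ n → f k ≈ 0#) → sumTo n f ≈ f 0
  sumTo-≈-head zero    _   = refl
  sumTo-≈-head (suc n) f≈0 = trans
    (+-cong (sumTo-≈-head n (λ k 0<k k≤n → f≈0 k 0<k (ℕ.m≤n⇒m≤1+n k≤n))) (f≈0 (suc n) (s≤s z≤n) ℕ.≤-refl))
    (+-identityʳ _)

  sumTo-extend : ∀ {k n} {f : ℕ → Carrier} → k ≤ n → (∀ j → k < j → f j ≈ 0#) → sumTo k f ≈ sumTo n f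
  sumTo-extend {k} {f = f} k≤n f≈0 = go (ℕ.≤⇒≤′ k≤n)
    where
    go : ∀ {n} → k ℕ.≤′ n → sumTo k f ≈ sumTo n f
    go ℕ.≤′-refl          = refl
    go (ℕ.≤′-step {n} k≤n) = begin
      sumTo k f            ≈⟨ go k≤n ⟩
      sumTo n f            ≈⟨ +-identityʳ _ ⟨
      sumTo n f + 0#       ≈⟨ +-cong refl (f≈0 (suc n) (s≤s (ℕ.≤′⇒≤ k≤n))) ⟨
      sumTo (suc n) f      ∎

  poch-cong : ∀ {x y} k → x ≈ y → poch x k ≈ poch y k
  poch-cong zero    x≈y = refl
  poch-cong (suc k) x≈y = *-cong (poch-cong k x≈y) (+-cong x≈y refl)

  poch-suc : ∀ x m → poch x (suc m) ≈ x * poch (x + 1#) m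
  poch-suc x zero    = begin
    1# * (x + 0#) ≈⟨ *-identityˡ _ ⟩
    x + 0#        ≈⟨ +-identityʳ x ⟩
    x             ≈⟨ *-identityʳ x ⟨
    x * 1#        ∎
  poch-suc x (suc m) = begin
    poch x (suc m) * (x + (1# + ι m))        ≈⟨ *-cong (poch-suc x m) refl ⟩
    (x * poch (x + 1#) m) * (x + (1# + ι m)) ≈⟨ *-assoc _ _ _ ⟩
    x * (poch (x + 1#) m * (x + (1# + ι m))) ≈⟨ *-cong refl (*-cong refl (+-assoc _ _ _)) ⟨
    x * (poch (x + 1#) m * ((x + 1#) + ι m)) ∎

  poch-neg-vanish : ∀ {k j} → k < j → poch (- ι k) j ≈ 0#
  poch-neg-vanish {k} k<j = go (ℕ.≤⇒≤′ k<j)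
    where
    go : ∀ {j} → suc k ℕ.≤′ j → poch (- ι k) j ≈ 0#
    go ℕ.≤′-refl        = trans (*-cong refl (-‿inverseˡ (ι k))) (zeroʳ _)
    go (ℕ.≤′-step k<j) = trans (*-cong (go k<j) refl) (zeroˡ _)

  poch-≉0 : ∀ {x} → (∀ m → x ≉ - ι m) → ∀ k → poch x k ≉ 0#
  poch-≉0 x≉-m zero    = 1≉0
  poch-≉0 x≉-m (suc k) = *-≉0 (poch-≉0 x≉-m k) (λ eq → x≉-m k (+-inverseˡ-unique _ _ eq))

  poch-ι-suc-≉0 : ∀ n k → poch (ι (suc n)) k ≉ 0#
  poch-ι-suc-≉0 n = poch-≉0 (ι-suc-≉-neg n)

  poch-neg-square : ∀ n → poch (- ι n) n * poch (- ι n) n ≈ fact n * fact n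
  poch-neg-square zero    = *-cong (sym (+-identityʳ 1#)) (sym (+-identityʳ 1#))
  poch-neg-square (suc n) = begin
    poch (- ι (suc n)) (suc n) * poch (- ι (suc n)) (suc n)
      ≈⟨ *-cong unfold unfold ⟩
    (- ι (suc n) * poch (- ι n) n) * (- ι (suc n) * poch (- ι n) n)
      ≈⟨ solve 2 (λ m p → (:- m :* p) :* (:- m :* p) := (m :* m) :* (p :* p)) refl (ι (suc n)) (poch (- ι n) n) ⟩
    (ι (suc n) * ι (suc n)) * (poch (- ι n) n * poch (- ι n) n)
      ≈⟨ *-cong refl (poch-neg-square n) ⟩
    (ι (suc n) * ι (suc n)) * (fact n * fact n)
      ≈⟨ solve 2 (λ m f → (m :* m) :* (f :* f) := (m :* f) :* (m :* f)) refl (ι (suc n)) (fact n) ⟩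
    (ι (suc n) * fact n) * (ι (suc n) * fact n)
      ≈⟨ *-cong (natEmb-* (suc n) (n !)) (natEmb-* (suc n) (n !)) ⟨
    fact (suc n) * fact (suc n) ∎
    where
    unfold : poch (- ι (suc n)) (suc n) ≈ - ι (suc n) * poch (- ι n) n
    unfold = trans (poch-suc _ n) (*-cong refl (poch-cong n
      (solve 2 (λ o m → :- (o :+ m) :+ o := :- m) refl 1# (ι n))))

  twice-poch-self : ∀ n → 0 < n → poch (ι n) n + poch (ι n) n ≈ poch (1# + ι n) n
  twice-poch-self (suc m) _ = *-cancelˡ (charZero m) (begin
    N * (P + P)            ≈⟨ solve 2 (λ n p → n :* (p :+ p) := p :* (n :+ n)) refl N P ⟩
    poch N (suc n)         ≈⟨ poch-suc N n ⟩
    N * poch (N + 1#) n    ≈⟨ *-cong refl (poch-cong n (+-comm N 1#)) ⟩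
    N * poch (1# + N) n    ∎)
    where
    n = suc m
    N = ι n
    P = poch N n

  poch-contiguity : ∀ K N m →
    (K - N) * (poch (1# - (1# + K)) (suc m) * poch (1# + K) (suc m))
      - (K + N) * (poch (1# - K) (suc m) * poch K (suc m))
    ≈ two * (ι (suc m) - N) * (poch (- K) (suc m) * poch K (suc m))
  poch-contiguity K N m = begin
    (K - N) * (poch (1# - (1# + K)) (suc m) * (c₂ * ((1# + K) + M)))
      - (K + N) * ((c₁ * ((1# - K) + M)) * poch K (suc m))
      ≈⟨ +-cong (*-cong refl (*-cong shift-neg refl)) (-‿cong (*-cong refl (*-cong refl shift-pos))) ⟩
    (K - N) * (((1# - (1# + K)) * c₁) * (c₂ * ((1# + K) + M)))
      - (K + N) * ((c₁ * ((1# - K) + M)) * (K * c₂))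
      ≈⟨ solve 6 (λ k n o m c₁ c₂ →
           (k :- n) :* (((o :- (o :+ k)) :* c₁) :* (c₂ :* ((o :+ k) :+ m)))
             :- (k :+ n) :* ((c₁ :* ((o :- k) :+ m)) :* (k :* c₂))
           := ((o :+ m :- n) :+ (o :+ m :- n)) :* ((:- k :* c₁) :* (k :* c₂)))
         refl K N 1# M c₁ c₂ ⟩
    ((ι (suc m) - N) + (ι (suc m) - N)) * ((- K * c₁) * (K * c₂))
      ≈⟨ *-cong (sym (two*x≈x+x _)) (*-cong (sym shift-negK) (sym shift-pos)) ⟩
    two * (ι (suc m) - N) * (poch (- K) (suc m) * poch K (suc m)) ∎
    where
    M = ι m
    c₁ = poch (1# - K) m
    c₂ = poch (1# + K) m
    shift-neg : poch (1# - (1# + K)) (suc m) ≈ (1# - (1# + K)) * c₁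
    shift-neg = trans (poch-suc _ m) (*-cong refl (poch-cong m
      (solve 2 (λ o k → (o :- (o :+ k)) :+ o := o :- k) refl 1# K)))
    shift-pos : poch K (suc m) ≈ K * c₂
    shift-pos = trans (poch-suc K m) (*-cong refl (poch-cong m (+-comm K 1#)))
    shift-negK : poch (- K) (suc m) ≈ - K * c₁
    shift-negK = trans (poch-suc (- K) m) (*-cong refl (poch-cong m (+-comm (- K) 1#)))

  -- The weights w_k and the coefficients E_j

  kernel : ℕ → ℕ → Carrier
  kernel j k = poch (- ι k) j * poch (ι k) j

  module Weights (n : ℕ) where
    N : Carrier
    N = ι n

    w : ℕ → Carrier
    w k = poch (- N) k / poch (1# + N) k

    w-zero : w 0 ≈ 1#
    w-zero = inverseʳ 1# 1≉0

    w-beyond : w (suc n) ≈ 0#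
    w-beyond = trans (*-cong (poch-neg-vanish {n} ℕ.≤-refl) refl) (zeroˡ _)

    w-recurrence : ∀ k → w (suc k) * ((1# + ι k) + N) ≈ w k * (ι k - N)
    w-recurrence k = begin
      ((X * (- N + K)) * (P * Q) ⁻¹) * ((1# + K) + N)
        ≈⟨ *-cong (*-cong refl (⁻¹-distrib-* (poch-ι-suc-≉0 n k) Q≉0))
                  (solve 3 (λ o k n → (o :+ k) :+ n := o :+ n :+ k) refl 1# K N) ⟩
      ((X * (- N + K)) * (P ⁻¹ * Q ⁻¹)) * Q
        ≈⟨ solve 6 (λ x n k p q q' → ((x :* (:- n :+ k)) :* (p :* q')) :* q := ((x :* p) :* (k :- n)) :* (q' :* q))
             refl X N K (P ⁻¹) Q (Q ⁻¹) ⟩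
      (w k * (K - N)) * (Q ⁻¹ * Q) ≈⟨ *-cong refl (*-inverseˡ Q≉0) ⟩
      (w k * (K - N)) * 1#         ≈⟨ *-identityʳ _ ⟩
      w k * (K - N)                ∎
      where
      K = ι k
      X = poch (- N) k
      P = poch (1# + N) k
      Q = 1# + N + K
      Q≉0 : Q ≉ 0#
      Q≉0 eq = charZero (n ℕ.+ k) (trans (natEmb-+ (suc n) k) eq)

    -- Summation by parts: by w-recurrence the summand is T (suc k) - T k.
    weighted-telescope : ∀ (h : ℕ → Carrier) →
      sumTo n (λ k → w k * ((ι k - N) * h (suc k) - (ι k + N) * h k)) ≈ - (N * h 0)
    weighted-telescope h = begin
      sumTo n (λ k → w k * ((ι k - N) * h (suc k) - (ι k + N) * h k))
        ≈⟨ sumTo-cong n (λ k _ → difference k) ⟩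
      sumTo n (λ k → T (suc k) - T k)   ≈⟨ sumTo-telescope n T ⟩
      T (suc n) - T 0                   ≈⟨ +-cong T-beyond (-‿cong T-zero) ⟩
      0# - N * h 0                      ≈⟨ +-identityˡ _ ⟩
      - (N * h 0)                       ∎
      where
      T : ℕ → Carrier
      T k = w k * (ι k + N) * h k
      difference : ∀ k → w k * ((ι k - N) * h (suc k) - (ι k + N) * h k) ≈ T (suc k) - T k
      difference k = begin
        w k * ((ι k - N) * h (suc k) - (ι k + N) * h k)
          ≈⟨ solve 5 (λ w k n h₁ h₀ → w :* ((k :- n) :* h₁ :- (k :+ n) :* h₀)
                                     := (w :* (k :- n)) :* h₁ :- w :* (k :+ n) :* h₀)
               refl (w k) (ι k) N (h (suc k)) (h k) ⟩
        (w k * (ι k - N)) * h (suc k) - T k ≈⟨ +-cong (*-cong (sym (w-recurrence k)) refl) refl ⟩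
        T (suc k) - T k                     ∎
      T-beyond : T (suc n) ≈ 0#
      T-beyond = trans (*-cong (trans (*-cong w-beyond refl) (zeroˡ _)) refl) (zeroˡ _)
      T-zero : T 0 ≈ N * h 0
      T-zero = *-cong (trans (*-cong w-zero (+-identityˡ N)) (*-identityˡ N)) refl

    kernelSum : ℕ → Carrier
    kernelSum j = sumTo n (λ k → w k * kernel j k)

    twice-kernelSum-zero : 0 < n → two * kernelSum 0 ≈ 1#
    twice-kernelSum-zero (s≤s {n = m} _) = *-cancelˡ (charZero m) (begin
      N * (two * kernelSum 0)              ≈⟨ *-cong refl (two*x≈x+x _) ⟩
      N * (kernelSum 0 + kernelSum 0)      ≈⟨ solve 2 (λ n e → n :* (e :+ e) := :- (:- (n :+ n) :* e)) refl N (kernelSum 0) ⟩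
      - (- (N + N) * kernelSum 0)          ≈⟨ -‿cong (sumTo-*ˡ n _ _) ⟨
      - sumTo n (λ k → - (N + N) * (w k * (1# * 1#)))
        ≈⟨ -‿cong (sumTo-cong n (λ k _ → difference k)) ⟩
      - sumTo n (λ k → w k * ((ι k - N) * 1# - (ι k + N) * 1#))
        ≈⟨ -‿cong (weighted-telescope (λ _ → 1#)) ⟩
      - - (N * 1#)                         ≈⟨ -‿involutive _ ⟩
      N * 1#                               ∎)
      where
      difference : ∀ k → - (N + N) * (w k * (1# * 1#)) ≈ w k * ((ι k - N) * 1# - (ι k + N) * 1#)
      difference k = begin
        - (N + N) * (w k * (1# * 1#))   ≈⟨ *-cong refl (trans (*-cong refl (*-identityˡ 1#)) (*-identityʳ _)) ⟩
        - (N + N) * w k                 ≈⟨ solve 3 (λ w k n → :- (n :+ n) :* w := w :* ((k :- n) :- (k :+ n))) refl (w k) (ι k) N ⟩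
        w k * ((ι k - N) - (ι k + N))   ≈⟨ *-cong refl (+-cong (*-identityʳ _) (-‿cong (*-identityʳ _))) ⟨
        w k * ((ι k - N) * 1# - (ι k + N) * 1#) ∎

    kernelSum-vanish : ∀ m → suc m < n → kernelSum (suc m) ≈ 0#
    kernelSum-vanish m m<n = *-cancelˡ c≉0 (begin
      c * kernelSum (suc m)                       ≈⟨ sumTo-*ˡ n c _ ⟨
      sumTo n (λ k → c * (w k * kernel (suc m) k)) ≈⟨ sumTo-cong n (λ k _ → difference k) ⟩
      sumTo n (λ k → w k * ((ι k - N) * h (suc k) - (ι k + N) * h k))
                                                  ≈⟨ weighted-telescope h ⟩
      - (N * h 0)                                 ≈⟨ -‿cong (trans (*-cong refl h-zero) (zeroʳ N)) ⟩
      - 0#                                        ≈⟨ -0#≈0# ⟩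
      0#                                          ≈⟨ zeroʳ c ⟨
      c * 0#                                      ∎)
      where
      c = two * (ι (suc m) - N)
      c≉0 : c ≉ 0#
      c≉0 = *-≉0 two-≉0 (λ eq → ℕ.<-irrefl (ι-injective (x∙y⁻¹≈ε⇒x≈y _ _ eq)) m<n)
      h : ℕ → Carrier
      h k = poch (1# - ι k) (suc m) * poch (ι k) (suc m)
      h-zero : h 0 ≈ 0#
      h-zero = trans (*-cong refl (trans (poch-suc 0# m) (zeroˡ _))) (zeroʳ _)
      difference : ∀ k → c * (w k * kernel (suc m) k) ≈ w k * ((ι k - N) * h (suc k) - (ι k + N) * h k)
      difference k = begin
        c * (w k * kernel (suc m) k) ≈⟨ solve 3 (λ c w e → c :* (w :* e) := w :* (c :* e)) refl c (w k) (kernel (suc m) k) ⟩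
        w k * (c * kernel (suc m) k) ≈⟨ *-cong refl (poch-contiguity (ι k) N m) ⟨
        w k * ((ι k - N) * h (suc k) - (ι k + N) * h k) ∎

    twice-kernelSum-last : 0 < n → two * kernelSum n ≈ fact n * fact n
    twice-kernelSum-last 0<n = begin
      two * kernelSum n                 ≈⟨ *-cong refl (sumTo-≈-last n (λ k k<n → lower-vanish k<n)) ⟩
      two * ((X * P ⁻¹) * (X * Y))      ≈⟨ two*x≈x+x _ ⟩
      (X * P ⁻¹) * (X * Y) + (X * P ⁻¹) * (X * Y)
        ≈⟨ solve 4 (λ x p' y y' → (x :* p') :* (x :* y) :+ (x :* p') :* (x :* y') := (x :* x) :* (p' :* (y :+ y')))
             refl X (P ⁻¹) Y Y ⟩
      (X * X) * (P ⁻¹ * (Y + Y))        ≈⟨ *-cong refl (*-cong refl (twice-poch-self n 0<n)) ⟩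
      (X * X) * (P ⁻¹ * P)              ≈⟨ *-cong refl (*-inverseˡ (poch-ι-suc-≉0 n n)) ⟩
      (X * X) * 1#                      ≈⟨ *-identityʳ _ ⟩
      X * X                             ≈⟨ poch-neg-square n ⟩
      fact n * fact n                   ∎
      where
      X = poch (- N) n
      Y = poch N n
      P = poch (1# + N) n
      lower-vanish : ∀ {k} → k < n → w k * kernel n k ≈ 0#
      lower-vanish k<n = trans (*-cong refl (trans (*-cong (poch-neg-vanish k<n) refl) (zeroˡ _))) (zeroʳ _)

  -- Expanding the sum at balanced parameters

  cancel-fraction : ∀ {x f q a b} → f ≉ 0# → q ≉ 0# → a ≉ 0# → b ≉ 0# →
    (x * f / (q * a * b)) * (a * b / f) ≈ x / q
  cancel-fraction {x} {f} {q} {a} {b} f≉0 q≉0 a≉0 b≉0 = begin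
    (x * f * (q * a * b) ⁻¹) * (a * b * f ⁻¹)
      ≈⟨ *-cong (*-cong refl (trans (⁻¹-distrib-* (*-≉0 q≉0 a≉0) b≉0) (*-cong (⁻¹-distrib-* q≉0 a≉0) refl))) refl ⟩
    (x * f * (q ⁻¹ * a ⁻¹ * b ⁻¹)) * (a * b * f ⁻¹)
      ≈⟨ solve 8 (λ x f q a b f' a' b' → (x :* f :* (q :* a' :* b')) :* (a :* b :* f')
                                        := (x :* q) :* ((f :* f') :* ((a :* a') :* (b :* b'))))
           refl x f (q ⁻¹) a b (f ⁻¹) (a ⁻¹) (b ⁻¹) ⟩
    (x / q) * ((f * f ⁻¹) * ((a * a ⁻¹) * (b * b ⁻¹)))
      ≈⟨ *-cong refl (*-cong (inverseʳ f f≉0) (*-cong (inverseʳ a a≉0) (inverseʳ b b≉0))) ⟩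
    (x / q) * (1# * (1# * 1#))
      ≈⟨ *-cong refl (trans (*-identityˡ _) (*-identityˡ 1#)) ⟩
    (x / q) * 1#   ≈⟨ *-identityʳ _ ⟩
    x / q          ∎

  -i^k*i^k≈1 : ∀ k → (- i) ^ k * i ^ k ≈ 1#
  -i^k*i^k≈1 zero    = *-identityˡ 1#
  -i^k*i^k≈1 (suc k) = begin
    (- i * (- i) ^ k) * (i * i ^ k) ≈⟨ solve 4 (λ a b c d → (a :* b) :* (c :* d) := (a :* c) :* (b :* d))
                                        refl (- i) ((- i) ^ k) i (i ^ k) ⟩
    (- i * i) * ((- i) ^ k * i ^ k) ≈⟨ *-cong -i*i≈1 (-i^k*i^k≈1 k) ⟩
    1# * 1#                         ≈⟨ *-identityˡ 1# ⟩
    1#                              ∎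
    where
    -i*i≈1 : - i * i ≈ 1#
    -i*i≈1 = trans (sym (-‿distribˡ-* i i)) (trans (-‿cong i²≈-1) (-‿involutive 1#))

  module Expansion (a b c d x : Carrier) (balanced : a + b + c + d ≈ 1#)
                   (a+c≉-m : ∀ m → a + c ≉ - ι m) (a+d≉-m : ∀ m → a + d ≉ - ι m) where
    A B Y : ℕ → Carrier
    A = poch (a + c)
    B = poch (a + d)
    Y = poch (a + i * x)

    u : ℕ → Carrier
    u j = Y j / (fact j * A j * B j)

    u-spec : ∀ j → u j * (fact j * A j * B j) ≈ Y j
    u-spec j = begin
      (Y j * D ⁻¹) * D  ≈⟨ *-assoc _ _ _ ⟩
      Y j * (D ⁻¹ * D)  ≈⟨ *-cong refl (*-inverseˡ (*-≉0 (*-≉0 (fact-≉0 j) (poch-≉0 a+c≉-m j)) (poch-≉0 a+d≉-m j))) ⟩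
      Y j * 1#          ≈⟨ *-identityʳ _ ⟩
      Y j               ∎
      where D = fact j * A j * B j

    u-zero : u 0 ≈ 1#
    u-zero = begin
      u 0                      ≈⟨ *-identityʳ _ ⟨
      u 0 * 1#                 ≈⟨ *-cong refl (trans (*-identityʳ _) (trans (*-identityʳ _) (+-identityʳ 1#))) ⟨
      u 0 * (fact 0 * 1# * 1#) ≈⟨ u-spec 0 ⟩
      1#                       ∎

    p-balanced : ∀ k → p k x a b c d ≈ i ^ k * (A k * B k / fact k) * sumTo k (λ j → kernel j k * u j)
    p-balanced k = *-cong refl (sumTo-cong k (λ j _ →
      trans (*-cong (*-cong (*-cong refl (poch-cong j parameter≈k)) refl) refl) (*-assoc _ _ _)))
      where
      parameter≈k : ι k + a + b + c + d - 1# ≈ ι k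
      parameter≈k = begin
        ι k + a + b + c + d - 1#     ≈⟨ solve 6 (λ k a b c d o → k :+ a :+ b :+ c :+ d :- o := k :+ (a :+ b :+ c :+ d :- o))
                                          refl (ι k) a b c d 1# ⟩
        ι k + (a + b + c + d - 1#)   ≈⟨ +-cong refl (trans (+-cong balanced refl) (-‿inverseʳ 1#)) ⟩
        ι k + 0#                     ≈⟨ +-identityʳ _ ⟩
        ι k                          ∎

    summand : ℕ → ℕ → Carrier
    summand n k = (- i) ^ k * (poch (- ι n) k * fact k / (poch (1# + ι n) k * A k * B k)) * p k x a b c d

    summand-expansion : ∀ n k → summand n k ≈ Weights.w n k * sumTo k (λ j → kernel j k * u j)
    summand-expansion n k = begin
      (s * r) * p k x a b c d                    ≈⟨ *-cong refl (p-balanced k) ⟩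
      (s * r) * (i ^ k * r' * S)                 ≈⟨ solve 5 (λ s r t r' S → (s :* r) :* (t :* r' :* S) := (s :* t) :* (r :* r') :* S)
                                                      refl s r (i ^ k) r' S ⟩
      (s * i ^ k) * (r * r') * S                 ≈⟨ *-cong (*-cong (-i^k*i^k≈1 k) fraction) refl ⟩
      1# * Weights.w n k * S                     ≈⟨ *-cong (*-identityˡ _) refl ⟩
      Weights.w n k * S                          ∎
      where
      s = (- i) ^ k
      r = poch (- ι n) k * fact k / (poch (1# + ι n) k * A k * B k)
      r' = A k * B k / fact k
      S = sumTo k (λ j → kernel j k * u j)
      fraction : r * r' ≈ Weights.w n k
      fraction = cancel-fraction (fact-≉0 k) (poch-ι-suc-≉0 n k) (poch-≉0 a+c≉-m k) (poch-≉0 a+d≉-m k)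

    sum-expansion : ∀ n → sumTo n (summand n) ≈ sumTo n (λ j → Weights.kernelSum n j * u j)
    sum-expansion n = begin
      sumTo n (summand n)
        ≈⟨ sumTo-cong n (λ k k≤n → trans (summand-expansion n k) (*-cong refl (sumTo-extend k≤n (upper-vanish k)))) ⟩
      sumTo n (λ k → w k * sumTo n (λ j → kernel j k * u j))
        ≈⟨ sumTo-cong n (λ k _ → sym (sumTo-*ˡ n (w k) _)) ⟩
      sumTo n (λ k → sumTo n (λ j → w k * (kernel j k * u j)))
        ≈⟨ sumTo-swap n n _ ⟩
      sumTo n (λ j → sumTo n (λ k → w k * (kernel j k * u j)))
        ≈⟨ sumTo-cong n (λ j _ → trans (sumTo-cong n (λ k _ → sym (*-assoc _ _ _))) (sumTo-*ʳ n (u j) _)) ⟩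
      sumTo n (λ j → kernelSum j * u j) ∎
      where
      open Weights n
      upper-vanish : ∀ k j → k < j → kernel j k * u j ≈ 0#
      upper-vanish k j k<j = trans (*-cong (trans (*-cong (poch-neg-vanish k<j) refl) (zeroˡ _)) refl) (zeroˡ _)

    sum-times-denominator : ∀ n → sumTo n (summand n) * (two * A n * B n) ≈ fact n * Y n + A n * B n
    sum-times-denominator zero = begin
      sumTo 0 (summand 0) * (two * 1# * 1#)   ≈⟨ *-cong (trans (sum-expansion 0) term≈1) (trans (*-identityʳ _) (*-identityʳ _)) ⟩
      1# * two                                ≈⟨ *-identityˡ two ⟩
      1# + 1#                                 ≈⟨ +-cong fact0*1≈1 (*-identityˡ 1#) ⟨
      fact 0 * 1# + 1# * 1#                   ∎
      where
      open Weights 0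
      term≈1 : kernelSum 0 * u 0 ≈ 1#
      term≈1 = trans (*-cong (trans (*-cong w-zero (*-identityˡ 1#)) (*-identityˡ 1#)) u-zero) (*-identityˡ 1#)
      fact0*1≈1 : fact 0 * 1# ≈ 1#
      fact0*1≈1 = trans (*-identityʳ _) (+-identityʳ 1#)
    sum-times-denominator n@(suc m) = begin
      sumTo n (summand n) * (two * A n * B n)
        ≈⟨ *-cong (trans (sum-expansion n) (+-cong (sumTo-≈-head m middle-vanish) refl)) refl ⟩
      (kernelSum 0 * u 0 + kernelSum n * u n) * (two * A n * B n)
        ≈⟨ solve 7 (λ t e₀ u₀ eₙ uₙ α β → (e₀ :* u₀ :+ eₙ :* uₙ) :* (t :* α :* β)
                                       := (t :* e₀) :* u₀ :* (α :* β) :+ (t :* eₙ) :* (uₙ :* (α :* β)))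
             refl two (kernelSum 0) (u 0) (kernelSum n) (u n) (A n) (B n) ⟩
      (two * kernelSum 0) * u 0 * (A n * B n) + (two * kernelSum n) * (u n * (A n * B n))
        ≈⟨ +-cong (*-cong (*-cong (twice-kernelSum-zero 0<n) u-zero) refl) (*-cong (twice-kernelSum-last 0<n) refl) ⟩
      1# * 1# * (A n * B n) + (fact n * fact n) * (u n * (A n * B n))
        ≈⟨ +-cong (trans (*-cong (*-identityˡ 1#) refl) (*-identityˡ _))
                  (solve 4 (λ f u α β → (f :* f) :* (u :* (α :* β)) := f :* (u :* (f :* α :* β))) refl (fact n) (u n) (A n) (B n)) ⟩
      A n * B n + fact n * (u n * (fact n * A n * B n))
        ≈⟨ +-cong refl (*-cong refl (u-spec n)) ⟩
      A n * B n + fact n * Y n          ≈⟨ +-comm _ _ ⟩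
      fact n * Y n + A n * B n          ∎
      where
      open Weights n
      0<n : 0 < n
      0<n = s≤s z≤n
      middle-vanish : ∀ k → 0 < k → k ≤ m → kernelSum k * u k ≈ 0#
      middle-vanish (suc k) _ k<m = trans (*-cong (kernelSum-vanish k (s≤s k<m)) refl) (zeroˡ _)

mainTheorem14 : {ℓc ℓ : Level} (F : CharZeroFieldWithI ℓc ℓ) →
    let open Hahn F in
    (a b c d x : Carrier) →
    a + b + c + d ≈ 1# →
    (∀ (m : ℕ) → ¬ (a + c ≈ - ι m)) →
    (∀ (m : ℕ) → ¬ (a + d ≈ - ι m)) →
    (n : ℕ) →
    sumTo n (λ k →
        ((- i) ^ k) * (poch (- ι n) k * fact k
          / (poch (1# + ι n) k * poch (a + c) k * poch (a + d) k))
        * p k x a b c d)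
      ≈ (fact n * poch (a + i * x) n + poch (a + c) n * poch (a + d) n)
          / ((1# + 1#) * poch (a + c) n * poch (a + d) n)
mainTheorem14 F a b c d x balanced a+c≉-m a+d≉-m n =
  /-unique (*-≉0 (*-≉0 two-≉0 (poch-≉0 a+c≉-m n)) (poch-≉0 a+d≉-m n)) (sum-times-denominator n)
  where
  open ContinuousHahn F
  open Expansion a b c d x balanced a+c≉-m a+d≉-m
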